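{- Let $(\Sigma, I, \to, \preceq)$ be a well-structured transition system and $P \subseteq \Sigma$ a downward-closed set, and suppose $\mathsf{Init} \mapsto^{*} \mathbf{R} \mid Q$ in the rule system described in the context. Then for every $\langle a, i\rangle \in Q$ there is a path $a \to^{*} b$ to some $b \in \Sigma \setminus P$.
   Context: A well-structured transition system (WSTS) $(\Sigma, I, \to, \preceq)$ consists of a set $\Sigma$ of states, a finite set $I \subseteq \Sigma$ of initial states, a relation $\to \subseteq \Sigma \times \Sigma$, and a well-quasi-order $\preceq$ on $\Sigma$ such that whenever $s_1 \to s_2$ and $s_1 \preceq t_1$, there is $t_2$ with $t_1 \to^{*} t_2$ and $s_2 \preceq t_2$. For $Y \subseteq \Sigma$, $\uparrow Y = \{x \mid \exists y \in Y,\ y \preceq x\}$ and $\downarrow Y = \{x \mid \exists y \in Y,\ x \preceq y\}$; $\uparrow x = \uparrow\{x\}$. For $X \subseteq \Sigma$, $\mathrm{pre}(X) = \{y \mid \exists x \in X,\ y \to x\}$. The rule system (generic version). Its states are $\mathsf{Init}$, $\mathsf{valid}$, $\mathsf{invalid}$, and pairs $\mathbf{R} \mid Q$ where $\mathbf{R} = (R_0, \ldots, R_N)$ ($N \ge 0$, called the length) is a vector of downward-closed subsets of $\Sigma$ and $Q$ is a finite priority queue of pairs $\langle a, i\rangle \in \Sigma \times \mathbb{N}$ with priority $i$; $\min Q$ is an element of least priority, $\mathrm{popMin}(Q)$ is $Q$ with that element removed, $\mathrm{push}(Q,x)$ is $Q$ with $x$ added. For $0 \le i \le N$ and $a \in \Sigma$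 let $\mathrm{Gen}_i(a) = \{ b \mid b \preceq a,\ \uparrow b \cap I = \emptyset,\ \mathrm{pre}(\uparrow b) \cap (R_i \setminus \uparrow b) = \emptyset\}$. $\mathbf{R}[R_k \gets R'_k]_{k=1}^i$ denotes $(R_0, R'_1, \ldots, R'_i, R_{i+1}, \ldots, R_N)$. The one-step relation $\mapsto$ is given by the rules: (Initialize) $\mathsf{Init} \mapsto (\downarrow I) \mid \emptyset$ (a vector of length $0$ with $R_0 = \downarrow I$). (CandidateNondet) if $a \in R_N \setminus P$: $\mathbf{R} \mid \emptyset \mapsto \mathbf{R} \mid \{\langle a, N\rangle\}$. (ModelSyn) if $\min Q = \langle a, 0\rangle$: $\mathbf{R}\mid Q \mapsto \mathsf{invalid}$. (ModelSem) if $\min Q = \langle a, i\rangle$ and $I \cap \uparrow a \neq \emptyset$: $\mathbf{R}\mid Q \mapsto \mathsf{invalid}$. (DecideNondet) if $\min Q = \langle a, i \rangle$, $i > 0$, $b \in \mathrm{pre}(\uparrow a) \cap (R_{i-1} \setminus \uparrow a)$: $\mathbf{R}\mid Q \mapsto \mathbf{R} \mid \mathrm{push}(Q, \langle b, i-1\rangle)$. (Conflict) if $\min Q = \langle a, i\rangle$, $i>0$, $\mathrm{pre}(\uparrow a) \cap (R_{i-1}\setminus \uparrow a) = \emptyset$ and $b \in \mathrm{Gen}_{i-1}(a)$: $\mathbf{R}\mid Q \mapsto \mathbf{R}[R_k \gets R_k \setminus \uparrow b]_{k=1}^{i} \mid \mathrm{popMin}(Q)$. (Induction) if $R_i = \Sigma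 \setminus \uparrow\{r_{i,1}, \ldots, r_{i,m}\}$ and $b \in \mathrm{Gen}_i(r_{i,j})$ for some $1 \le j \le m$: $\mathbf{R} \mid \emptyset \mapsto \mathbf{R}[R_k \gets R_k \setminus \uparrow b]_{k=1}^{i+1} \mid \emptyset$. (Valid) if $R_i = R_{i+1}$ for some $i < N$: $\mathbf{R}\mid Q \mapsto \mathsf{valid}$. (Unfold) if $R_N \subseteq P$: $\mathbf{R} \mid \emptyset \mapsto (R_0, \ldots, R_N, \Sigma) \mid \emptyset$. $\mapsto^{*}$ is the reflexive-transitive closure of $\mapsto$. -}

module Defs where

open import Level using (0ℓ)
open import Data.Nat using (ℕ; zero; suc; _<_; _≤_; _≤ᵇ_)
open import Data.Fin using (Fin; zero; suc; toℕ; fromℕ; inject₁)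
open import Data.Bool using (Bool; true; false; if_then_else_; _∧_)
open import Data.Product using (Σ; ∃; _×_; _,_; proj₂)
open import Data.List using (List; []; _∷_; _++_)
open import Data.List.Relation.Unary.All using (All)
open import Data.List.Relation.Unary.Any using (Any)
open import Data.List.Membership.Propositional using (_∈_)
open import Relation.Nullary using (¬_)
open import Relation.Binary.PropositionalEquality using (_≡_)
open import Relation.Binary.Construct.Closure.ReflexiveTransitive using (Star)
open import Function.Bundles using (_⇔_)
open import Data.Unit using (⊤)

record WSTS : Set₁ where
  field
    St      : Set
    I       : List St
    _⟶_     : St → St → Set
    _≼_     : St → St → Set
    ≼-refl  : ∀ x → x ≼ x
    ≼-trans : ∀ x y z → x ≼ y → y ≼ z → x ≼ z
    ≼-wqo   : (f : ℕ → St) → ∃ λ i → ∃ λ j → (i < j) × (f i ≼ f j)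
    compat  : ∀ s₁ s₂ t₁ → s₁ ⟶ s₂ → s₁ ≼ t₁ →
              ∃ λ t₂ → Star _⟶_ t₁ t₂ × (s₂ ≼ t₂)

DownClosed : (W : WSTS) → (WSTS.St W → Set) → Set
DownClosed W P = ∀ x y → WSTS._≼_ W y x → P x → P y

module RuleSystem (W : WSTS) (P : WSTS.St W → Set) where
  open WSTS W

  Pred : Set₁
  Pred = St → Set

  _⟶*_ : St → St → Set
  _⟶*_ = Star _⟶_

  ↓I : Pred
  ↓I x = ∃ λ y → (y ∈ I) × (x ≼ y)

  Frames : ℕ → Set₁
  Frames N = Fin (suc N) → Pred

  -- priority queue: a finite list (multiset) of pairs ⟨a , i⟩
  Queue : Set
  Queue = List (St × ℕ)

  PreUpDiff : St → Pred → St → Set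
  PreUpDiff a S b = (∃ λ x → (a ≼ x) × (b ⟶ x)) × S b × ¬ (a ≼ b)

  Gen : ∀ {N} → Frames N → Fin (suc N) → St → St → Set
  Gen R i a b = (b ≼ a)
              × (∀ x → x ∈ I → ¬ (b ≼ x))
              × (∀ y → ¬ PreUpDiff b (R i) y)

  -- R[R_k ← R_k ∖ ↑ b]_{k=1}^{i}  (indices beyond N are ignored)
  update : ∀ {N} → Frames N → ℕ → St → Frames N
  update R i b k x =
    if (1 ≤ᵇ toℕ k) ∧ (toℕ k ≤ᵇ i) then (R k x × ¬ (b ≼ x)) else R k x

  extend : ∀ {N} → Frames N → Pred → Frames (suc N)
  extend {zero}  R S zero          = R zero
  extend {zero}  R S (suc zero)    = S
  extend {suc N} R S zero          = R zero
  extend {suc N} R S (suc k)       = extend {N} (λ j → R (suc j)) S k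

  -- min Q = ⟨a , i⟩ and popMin Q = Q′ :
  -- Q = pre ++ ⟨a , i⟩ ∷ post, every priority in Q is ≥ i, Q′ = pre ++ post
  record MinPop (Q : Queue) (a : St) (i : ℕ) (Q′ : Queue) : Set where
    field
      pre post : Queue
      split    : Q ≡ pre ++ ((a , i) ∷ post)
      least    : All (λ p → i ≤ proj₂ p) Q
      popped   : Q′ ≡ pre ++ post

  data State : Set₁ where
    Init valid invalid : State
    cfg : (N : ℕ) → Frames N → Queue → State

  data _↦_ : State → State → Set₁ where
    initialize : Init ↦ cfg zero (λ _ → ↓I) []
    candidateNondet : ∀ {N} {R : Frames N} {a} →
      R (fromℕ N) a → ¬ P a →
      cfg N R [] ↦ cfg N R ((a , N) ∷ [])
    modelSyn : ∀ {N} {R : Frames N} {Q a Q′} →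
      MinPop Q a 0 Q′ →
      cfg N R Q ↦ invalid
    modelSem : ∀ {N} {R : Frames N} {Q a i Q′} →
      MinPop Q a i Q′ → (∃ λ x → (x ∈ I) × (a ≼ x)) →
      cfg N R Q ↦ invalid
    -- i > 0 is encoded as i = suc (toℕ j) with j = i - 1 an index of R
    decideNondet : ∀ {N} {R : Frames N} {Q a Q′ b} (j : Fin (suc N)) →
      MinPop Q a (suc (toℕ j)) Q′ → PreUpDiff a (R j) b →
      cfg N R Q ↦ cfg N R ((b , toℕ j) ∷ Q)
    conflict : ∀ {N} {R : Frames N} {Q a Q′ b} (j : Fin (suc N)) →
      MinPop Q a (suc (toℕ j)) Q′ →
      (∀ y → ¬ PreUpDiff a (R j) y) →
      Gen R j a b →
      cfg N R Q ↦ cfg N (update R (suc (toℕ j)) b) Q′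
    induction : ∀ {N} {R : Frames N} {b} (i : Fin (suc N)) (rs : List St) →
      (∀ x → R i x ⇔ (¬ Any (λ r → r ≼ x) rs)) →
      (∃ λ r → (r ∈ rs) × Gen R i r b) →
      cfg N R [] ↦ cfg N (update R (suc (toℕ i)) b) []
    valid-rule : ∀ {N} {R : Frames N} {Q} (i : Fin N) →
      (∀ x → R (inject₁ i) x ⇔ R (suc i) x) →
      cfg N R Q ↦ valid
    unfold : ∀ {N} {R : Frames N} →
      (∀ x → R (fromℕ N) x → P x) →
      cfg N R [] ↦ cfg (suc N) (extend R (λ _ → ⊤)) []

  _↦*_ : State → State → Set₁
  _↦*_ = Star _↦_

-- "Every queued state can escape P" is an invariant of the rule system.
-- A candidate ⟨a , N⟩ is itself outside P. A decided b steps into some x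
-- above the current minimum a; by compatibility the escaping run from a is
-- simulated from x, ending above a state outside P, hence (P being downward
-- closed) outside P itself. Conflict only removes queue entries, and every
-- other rule empties the queue or leaves the configurations.
module Submission where

open import Defs
open import Data.Nat using (ℕ)
open import Data.Product using (∃; _×_; _,_)
open import Data.List.Membership.Propositional using (_∈_)
open import Data.List.Membership.Propositional.Properties using (∈-insert)
open import Data.List.Relation.Binary.Subset.Propositional using (_⊆_)
open import Data.List.Relation.Binary.Subset.Propositional.Properties using (++⁺ʳ; xs⊆x∷xs)
open import Data.List.Relation.Unary.Any using (here; there)
open import Data.Unit using (⊤; tt)
open import Function using (id; _∘_; _∘′_)
open import Relation.Nullary using (¬_)
open import Relation.Binary.PropositionalEquality using (refl)
open import Relation.Binary.Construct.Closure.ReflexiveTransitive using (Star; ε; _◅_; _◅◅_; fold)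

module Simulation (W : WSTS) where
  open WSTS W

  ⟶*-compat : ∀ {a c x} → Star _⟶_ a c → a ≼ x → ∃ λ d → Star _⟶_ x d × c ≼ d
  ⟶*-compat ε a≼x = _ , ε , a≼x
  ⟶*-compat (a⟶b ◅ b⟶*c) a≼x with compat _ _ _ a⟶b a≼x
  ... | y , x⟶*y , b≼y with ⟶*-compat b⟶*c b≼y
  ... | d , y⟶*d , c≼d = d , x⟶*y ◅◅ y⟶*d , c≼d

module Escape (W : WSTS) (P : WSTS.St W → Set) (P-down : DownClosed W P) where
  open WSTS W
  open RuleSystem W P
  open Simulation W

  Escapes : St → Set
  Escapes a = ∃ λ b → a ⟶* b × ¬ P b

  Escapes-↑ : ∀ {a x} → a ≼ x → Escapes a → Escapes x
  Escapes-↑ a≼x (c , a⟶*c , c∉P) with ⟶*-compat a⟶*c a≼x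
  ... | d , x⟶*d , c≼d = d , x⟶*d , c∉P ∘ P-down d c c≼d

  Escapes-◅ : ∀ {b x} → b ⟶ x → Escapes x → Escapes b
  Escapes-◅ b⟶x (c , x⟶*c , c∉P) = c , b⟶x ◅ x⟶*c , c∉P

  Escapes-pre↑ : ∀ {a b} → (∃ λ x → a ≼ x × b ⟶ x) → Escapes a → Escapes b
  Escapes-pre↑ (x , a≼x , b⟶x) = Escapes-◅ b⟶x ∘ Escapes-↑ a≼x

  module _ {Q a i Q′} (m : MinPop Q a i Q′) where
    open MinPop m

    MinPop-min∈ : (a , i) ∈ Q
    MinPop-min∈ rewrite split = ∈-insert pre

    MinPop-popped⊆ : Q′ ⊆ Q
    MinPop-popped⊆ rewrite split | popped = ++⁺ʳ pre (xs⊆x∷xs post (a , i))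

  QueueEscapes : State → Set
  QueueEscapes (cfg N R Q) = ∀ a i → (a , i) ∈ Q → Escapes a
  QueueEscapes _           = ⊤

  ↦-preserves-QueueEscapes : ∀ {s t} → s ↦ t → QueueEscapes s → QueueEscapes t
  ↦-preserves-QueueEscapes initialize _ _ _ ()
  ↦-preserves-QueueEscapes (candidateNondet _ a∉P) _ a _ (here refl) = a , ε , a∉P
  ↦-preserves-QueueEscapes (candidateNondet _ _)   _ _ _ (there ())
  ↦-preserves-QueueEscapes (modelSyn _)   _ = tt
  ↦-preserves-QueueEscapes (modelSem _ _) _ = tt
  ↦-preserves-QueueEscapes (decideNondet _ m (b∈pre↑a , _)) inv _ _ (here refl) =
    Escapes-pre↑ b∈pre↑a (inv _ _ (MinPop-min∈ m))
  ↦-preserves-QueueEscapes (decideNondet _ _ _) inv a i (there a∈Q) = inv a i a∈Q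
  ↦-preserves-QueueEscapes (conflict _ m _ _) inv a i a∈Q′ = inv a i (MinPop-popped⊆ m a∈Q′)
  ↦-preserves-QueueEscapes (induction _ _ _ _) _ _ _ ()
  ↦-preserves-QueueEscapes (valid-rule _ _)    _ = tt
  ↦-preserves-QueueEscapes (unfold _)          _ _ _ ()

  ↦*-preserves-QueueEscapes : ∀ {s t} → s ↦* t → QueueEscapes s → QueueEscapes t
  ↦*-preserves-QueueEscapes run =
    fold (λ s t → QueueEscapes s → QueueEscapes t) (λ st k → k ∘′ ↦-preserves-QueueEscapes st) id run

lemma2 : (W : WSTS) (P : WSTS.St W → Set) → DownClosed W P →
         (N : ℕ) (R : RuleSystem.Frames W P N) (Q : RuleSystem.Queue W P) →
         RuleSystem._↦*_ W P (RuleSystem.Init) (RuleSystem.cfg N R Q) →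
         ∀ a i → (a , i) ∈ Q →
         ∃ λ b → RuleSystem._⟶*_ W P a b × ¬ P b
lemma2 W P P-down N R Q run = ↦*-preserves-QueueEscapes run tt
  where open Escape W P P-down
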